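{- Let $T$ be a well-separated tree metric with distance function $d$ whose nodes form the alphabet $\Sigma$, let $r\ge 1$, let $1\le\alpha\le n$, and let $x,y\in\Sigma^{\le n}$. Then: (1) if $l_1$ is a letter of $s_r(x)$, $l_2$ is a letter of $s_r(y)$ and $l_1\ne l_2$, then $d(l_1,l_2)>r/4$; (2) if $\mathrm{DTW}(x,y)\le nr/\alpha$ then $\mathrm{DTW}(s_r(x),s_r(y))\le nr/\alpha$ and $\mathrm{DTW}_0(s_r(x),s_r(y))\le 4n/\alpha$; (3) if $\mathrm{DTW}(x,y)>nr$ then $\mathrm{DTW}(s_r(x),s_r(y))>nr/2$.
   Context: A well-separated tree metric: $T$ is a rooted tree whose nodes are the letters of $\Sigma$, with positive edge weights that are non-increasing along every root-to-leaf path; the distance between two nodes is the weight of the heaviest edge on the tree path between them. For $x\in\Sigma^{\le n}$ and $r\ge1$, the $r$-simplification $s_r(x)$ is obtained by replacing each letter $l$ of $x$ with the highest ancestor of $l$ in $T$ reachable from $l$ using only edges of weight at most $r/4$. A run is a maximal substring of one repeated letter; an expansion of a string is obtained by lengthening its runs; a correspondence between $x,y$ is a pair $(\bar x,\bar y)$ of equal-length expansions of $x,y$ with cost $\sum_i d(\bar x_i,\bar y_i)$; $\mathrm{DTW}(x,y)$ is the minimum cost; $\mathrm{DTW}_0$ is the same with $d$ replaced by the discrete metric ($1$ on distinct letters).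
   Formalization: The edge weights of $T$ and the parameters $r$ and $\alpha$ are rational. -}

module Defs where

open import Data.Nat using (ℕ; zero; suc)
open import Data.Fin using (Fin)
open import Data.Fin.Properties using (_≟_)
open import Data.Bool using (Bool; true; false; if_then_else_; _xor_; not)
open import Data.List using (List; []; _∷_; iterate; allFin; foldr; zipWith; length; map)
open import Data.Bool.ListAction using (any)
open import Data.Product using (∃)
open import Data.List.Membership.Propositional using (_∈_)
open import Data.Rational using (ℚ; 0ℚ; _≤_; _<_; _⊔_; _+_; _*_; _≤ᵇ_)
open import Data.Rational using () renaming (_/_ to _//_)
open import Data.Integer using (+_)
open import Relation.Nullary using (¬_)
open import Relation.Nullary.Decidable using (⌊_⌋)
open import Relation.Binary.PropositionalEquality using (_≡_; _≢_)

-- A rooted tree on the node set Fin k (the alphabet Σ), given by a parent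
-- function; wt v is the weight of the edge between v and its parent
-- (meaningless for the root).
record WSTree (k : ℕ) : Set where
  field
    root   : Fin k
    parent : Fin k → Fin k
    wt     : Fin k → ℚ
    parent-root : parent root ≡ root
    -- every node reaches the root within k steps (so the parent graph is a tree)
    reaches     : ∀ u → root ∈ iterate parent u k
    positive    : ∀ v → v ≢ root → 0ℚ < wt v
    nonincr     : ∀ v → v ≢ root → parent v ≢ root → wt v ≤ wt (parent v)

module _ {k : ℕ} (T : WSTree k) where
  open WSTree T

  ancestors : Fin k → List (Fin k)
  ancestors u = iterate parent u k

  isAnc : Fin k → Fin k → Bool
  isAnc w u = any (λ a → ⌊ a ≟ w ⌋) (ancestors u)

  -- the edge (w, parent w) lies on the tree path between u and v iff w is not the
  -- root and w is an ancestor of exactly one of u, v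
  onPath : Fin k → Fin k → Fin k → Bool
  onPath u v w = not ⌊ w ≟ root ⌋ Data.Bool.∧ (isAnc w u xor isAnc w v)

  -- tree distance: weight of the heaviest edge on the path (0 if u = v)
  dist : Fin k → Fin k → ℚ
  dist u v = foldr (λ w m → if onPath u v w then wt w ⊔ m else m) 0ℚ (allFin k)

  climb : ℚ → ℕ → Fin k → Fin k
  climb c zero    l = l
  climb c (suc f) l =
    if ⌊ l ≟ root ⌋ then l
    else (if wt l ≤ᵇ c then climb c f (parent l) else l)

  simp : ℚ → List (Fin k) → List (Fin k)
  simp r = map (climb (r * ((+ 1) // 4)) k)

data Expansion {A : Set} : List A → List A → Set where
  [] : Expansion [] []
  keep : ∀ {a xs ys} → Expansion xs ys → Expansion (a ∷ xs) (a ∷ ys)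
  dup  : ∀ {a xs ys} → Expansion (a ∷ xs) (a ∷ ys) → Expansion (a ∷ xs) (a ∷ a ∷ ys)

record Correspondence {A : Set} (x y : List A) : Set where
  constructor corr
  field
    xbar ybar : List A
    expx : Expansion x xbar
    expy : Expansion y ybar
    samelen : length xbar ≡ length ybar

cost : {A : Set} (δ : A → A → ℚ) {x y : List A} → Correspondence x y → ℚ
cost δ c = foldr _+_ 0ℚ (zipWith δ (Correspondence.xbar c) (Correspondence.ybar c))

-- DTW with respect to δ is the minimum cost over correspondences; we express
-- comparisons with it:  DTW ≤ c  and  DTW > c  (DTW = ∞ if no correspondence).
DTW≤ : {A : Set} (δ : A → A → ℚ) → List A → List A → ℚ → Set
DTW≤ δ x y c = ∃ λ (p : Correspondence x y) → cost δ p ≤ c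

DTW> : {A : Set} (δ : A → A → ℚ) → List A → List A → ℚ → Set
DTW> δ x y c = ∀ (p : Correspondence x y) → c < cost δ p

discrete : {k : ℕ} → Fin k → Fin k → ℚ
discrete a b = if ⌊ a ≟ b ⌋ then 0ℚ else Data.Rational.1ℚ

module Submission where

-- Let c = r/4 and let s = climb c be
-- the map sending a letter to its highest ancestor reachable through edges of
-- weight ≤ c, so that s_r(x) = map s x.  Everything follows from two facts:
--   near:  d(l, s l) ≤ c, because the path from l to s l uses only edges of
--          weight ≤ c and d is the heaviest edge on the path;
--   stop:  s l is the root or its parent edge weighs more than c, and two
--          distinct such nodes are more than c apart, since one of them is
--          not an ancestor of the other and its parent edge separates them.
-- "stop" is part (1).  In any ultrametric a map with these two properties
-- satisfies d(s a, s b) ≤ d(a, b) ≤ d(s a, s b) + c and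
-- c·[s a ≠ s b] ≤ d(s a, s b).  Part (2) pushes a cheap correspondence of
-- x, y through s and sums the first and last bound.  Part (3) lifts a
-- correspondence of s_r(x), s_r(y) back to one of x, y, shortened to length
-- ≤ |x| + |y| ≤ 2n, so the pointwise error c costs at most 2n·r/4 = nr/2.
-- The file develops in turn: naturals as rationals, maxima over lists,
-- iterated maps, the tree metric and the climbing map (near, stop),
-- sums along correspondences, mapping/lifting/shortening correspondences,
-- snapping in an ultrametric together with its effect on DTW, and the
-- budget arithmetic; the lemma then instantiates the snapping module.

open import Defs
open import Data.Nat using (ℕ)
open import Data.Fin using (Fin)
open import Data.List using (List; length)
open import Data.List.Membership.Propositional using (_∈_)
open import Data.Rational using (ℚ; 1ℚ; _≤_; _<_; _*_; _÷_; NonZero)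
open import Data.Rational using () renaming (_/_ to _//_)
open import Data.Integer using (+_)
open import Data.Product using (_×_)
open import Relation.Binary.PropositionalEquality using (_≢_)

import Data.Nat as N
open N using (zero; suc; z≤n; s≤s)
import Data.Nat.Properties as ℕP
import Data.Nat.GeneralisedArithmetic as GA
import Data.Integer as ℤ
import Data.Integer.Properties as ℤP
import Data.Rational.Unnormalised as U
import Data.Rational.Unnormalised.Properties as UP
open import Data.Nat.Coprimality using (1-coprimeTo) renaming (sym to coprime-sym)
open import Data.Rational using (0ℚ; _+_; _⊔_; _≤ᵇ_; 1/_; mkℚ; *≤*; Positive; toℚᵘ; _<?_; positive; nonNegative)
open import Data.Rational.Properties hiding (_≟_)
open import Data.Rational.Solver using (module +-*-Solver)
open import Data.Fin.Properties using (_≟_)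
open import Data.Bool using (Bool; true; false; not; _∧_; _xor_; if_then_else_)
open import Data.Bool.Properties using (xor-same; xor-comm; ∧-zeroʳ; ⇔→≡; T-≡)
open import Data.List using ([]; _∷_; map; foldr; zipWith; allFin)
open import Data.List.Properties using (length-map)
import Data.List.Relation.Unary.Any as Any
open import Data.List.Relation.Unary.Any using (here; there)
open import Data.List.Relation.Unary.Any.Properties using (any⁺; any⁻)
open import Data.List.Membership.Propositional.Properties using (∈-allFin; ∈-map⁻)
open import Data.Product using (Σ; ∃; _,_)
open import Data.Sum using (_⊎_; inj₁; inj₂; [_,_]′)
open import Data.Empty using (⊥-elim)
open import Function.Bundles using (Equivalence; mk⇔)
open import Relation.Nullary using (yes; no)
open import Relation.Nullary.Decidable using (⌊_⌋; toWitness; fromWitness)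
open import Relation.Binary.PropositionalEquality
  using (_≡_; refl; sym; trans; cong; cong₂; subst; subst₂; module ≡-Reasoning)

fromℕ : ℕ → ℚ
fromℕ m = (+ m) // 1

fromℕ-normal : ∀ m → fromℕ m ≡ mkℚ (+ m) 0 (coprime-sym (1-coprimeTo m))
fromℕ-normal m = normalize-coprime (coprime-sym (1-coprimeTo m))

fromℕ-+ : ∀ a b → fromℕ (a N.+ b) ≡ fromℕ a + fromℕ b
fromℕ-+ a b = toℚᵘ-injective (UP.≃-trans unnormalised (UP.≃-sym (toℚᵘ-homo-+ (fromℕ a) (fromℕ b))))
  where
  unnormalised : toℚᵘ (fromℕ (a N.+ b)) U.≃ toℚᵘ (fromℕ a) U.+ toℚᵘ (fromℕ b)
  unnormalised rewrite fromℕ-normal a | fromℕ-normal b | fromℕ-normal (a N.+ b) =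
    U.*≡* (cong (ℤ._* + 1) (sym (cong₂ ℤ._+_ (ℤP.*-identityʳ (+ a)) (ℤP.*-identityʳ (+ b)))))

fromℕ-mono : ∀ {a b} → a N.≤ b → fromℕ a ≤ fromℕ b
fromℕ-mono {a} {b} a≤b rewrite fromℕ-normal a | fromℕ-normal b =
  *≤* (subst₂ ℤ._≤_ (sym (ℤP.*-identityʳ (+ a))) (sym (ℤP.*-identityʳ (+ b))) (ℤ.+≤+ a≤b))

≤-+-nonnegˡ : ∀ {p d} → 0ℚ ≤ d → p ≤ d + p
≤-+-nonnegˡ {p} {d} 0≤d = subst (_≤ d + p) (+-identityˡ p) (+-monoˡ-≤ p 0≤d)

≤-+-nonnegʳ : ∀ {p d} → 0ℚ ≤ d → p ≤ p + d
≤-+-nonnegʳ {p} {d} 0≤d = subst (_≤ p + d) (+-identityʳ p) (+-monoʳ-≤ p 0≤d)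

≤-⊔-drop : ∀ {e p q} → e ≤ p ⊔ q → p < e → e ≤ q
≤-⊔-drop {e} {p} {q} e≤p⊔q p<e with ⊔-sel p q
... | inj₁ p⊔q≡p = ⊥-elim (<-irrefl refl (<-≤-trans p<e (subst (e ≤_) p⊔q≡p e≤p⊔q)))
... | inj₂ p⊔q≡q = subst (e ≤_) p⊔q≡q e≤p⊔q

+-cancelʳ-< : ∀ {a b e} → a + b < e + b → a < e
+-cancelʳ-< {a} {b} {e} a+b<e+b with a <? e
... | yes a<e = a<e
... | no a≮e = ⊥-elim (<-irrefl refl (<-≤-trans a+b<e+b (+-monoˡ-≤ b (≮⇒≥ a≮e))))

maxWhere : {A : Set} → (A → Bool) → (A → ℚ) → List A → ℚ
maxWhere p f = foldr (λ w m → if p w then f w ⊔ m else m) 0ℚ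

module _ {A : Set} (f : A → ℚ) where

  maxWhere-nonneg : ∀ p ws → 0ℚ ≤ maxWhere p f ws
  maxWhere-nonneg p [] = ≤-refl
  maxWhere-nonneg p (w ∷ ws) with p w
  ... | true = ≤-trans (maxWhere-nonneg p ws) (p≤q⊔p (f w) _)
  ... | false = maxWhere-nonneg p ws

  maxWhere-lub : ∀ p ws {b} → 0ℚ ≤ b → (∀ w → p w ≡ true → f w ≤ b) → maxWhere p f ws ≤ b
  maxWhere-lub p [] 0≤b bound = 0≤b
  maxWhere-lub p (w ∷ ws) 0≤b bound with p w in pw
  ... | true = ⊔-lub (bound w pw) (maxWhere-lub p ws 0≤b bound)
  ... | false = maxWhere-lub p ws 0≤b bound

  maxWhere-≥ : ∀ p {ws w} → w ∈ ws → p w ≡ true → f w ≤ maxWhere p f ws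
  maxWhere-≥ p {w ∷ ws} (here refl) pw rewrite pw = p≤p⊔q (f w) _
  maxWhere-≥ p {v ∷ ws} (there w∈ws) pw with p v
  ... | true = ≤-trans (maxWhere-≥ p w∈ws pw) (p≤q⊔p (f v) _)
  ... | false = maxWhere-≥ p w∈ws pw

  maxWhere-cong : ∀ {p q} → (∀ w → p w ≡ q w) → ∀ ws → maxWhere p f ws ≡ maxWhere q f ws
  maxWhere-cong p≗q [] = refl
  maxWhere-cong p≗q (w ∷ ws) rewrite p≗q w | maxWhere-cong p≗q ws = refl

  maxWhere-none : ∀ p → (∀ w → p w ≡ false) → ∀ ws → maxWhere p f ws ≡ 0ℚ
  maxWhere-none p none [] = refl
  maxWhere-none p none (w ∷ ws) rewrite none w = maxWhere-none p none ws

module _ {A : Set} (f : A → A) where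

  ∈-iterate⁻ : ∀ m u {w} → w ∈ Data.List.iterate f u m → ∃ λ i → i N.< m × GA.iterate f u i ≡ w
  ∈-iterate⁻ (suc m) u (here refl) = 0 , s≤s z≤n , refl
  ∈-iterate⁻ (suc m) u (there w∈) with ∈-iterate⁻ m (f u) w∈
  ... | i , i<m , fⁱfu≡w = suc i , s≤s i<m , fⁱfu≡w

  ∈-iterate⁺ : ∀ m u i → i N.< m → GA.iterate f u i ∈ Data.List.iterate f u m
  ∈-iterate⁺ (suc m) u zero _ = here refl
  ∈-iterate⁺ (suc m) u (suc i) (s≤s i<m) = there (∈-iterate⁺ m (f u) i i<m)

  iterate-+ : ∀ i j u → GA.iterate f u (i N.+ j) ≡ GA.iterate f (GA.iterate f u i) j
  iterate-+ zero j u = refl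
  iterate-+ (suc i) j u = iterate-+ i j (f u)

  iterate-fixed : ∀ {z} → f z ≡ z → ∀ i → GA.iterate f z i ≡ z
  iterate-fixed fz≡z zero = refl
  iterate-fixed fz≡z (suc i) rewrite fz≡z = iterate-fixed fz≡z i

-- Two tests for the edge above a node: if it separates u from v then it
-- separates u from m or m from v; it never separates a node from itself.
xor-split : ∀ r a b m → r ∧ (a xor b) ≡ true → r ∧ (a xor m) ≡ true ⊎ r ∧ (m xor b) ≡ true
xor-split true true true m ()
xor-split true true false true _ = inj₂ refl
xor-split true true false false _ = inj₁ refl
xor-split true false true true _ = inj₁ refl
xor-split true false true false _ = inj₂ refl
xor-split true false false m ()
xor-split false a b m ()

xor-self : ∀ r a → r ∧ (a xor a) ≡ false
xor-self r a = trans (cong (r ∧_) (xor-same a)) (∧-zeroʳ r)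

module TreeMetric {k : ℕ} (T : WSTree k) where
  open WSTree T

  up : ℕ → Fin k → Fin k
  up i u = GA.iterate parent u i

  reach : ∀ u → ∃ λ t → t N.< k × up t u ≡ root
  reach u = ∈-iterate⁻ parent k u (reaches u)

  up-≥ : ∀ {t m u} → t N.≤ m → up t u ≡ root → up m u ≡ root
  up-≥ {t} {m} {u} t≤m uptu≡root = begin
    up m u                     ≡⟨ cong (λ i → up i u) (sym (ℕP.m+[n∸m]≡n t≤m)) ⟩
    up (t N.+ (m N.∸ t)) u     ≡⟨ iterate-+ parent t (m N.∸ t) u ⟩
    up (m N.∸ t) (up t u)      ≡⟨ cong (up (m N.∸ t)) uptu≡root ⟩
    up (m N.∸ t) root          ≡⟨ iterate-fixed parent parent-root (m N.∸ t) ⟩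
    root                       ∎
    where open ≡-Reasoning

  isAnc⇒∈ : ∀ w u → isAnc T w u ≡ true → w ∈ ancestors T u
  isAnc⇒∈ w u isA = Any.map (λ a≟w → sym (toWitness a≟w)) (any⁻ _ _ (Equivalence.from T-≡ isA))

  ∈⇒isAnc : ∀ w u → w ∈ ancestors T u → isAnc T w u ≡ true
  ∈⇒isAnc w u w∈ = Equivalence.to T-≡ (any⁺ _ (Any.map (λ w≡a → fromWitness (sym w≡a)) w∈))

  isAnc⁻ : ∀ w u → isAnc T w u ≡ true → ∃ λ i → up i u ≡ w
  isAnc⁻ w u isA with ∈-iterate⁻ parent k u (isAnc⇒∈ w u isA)
  ... | i , _ , upiu≡w = i , upiu≡w

  isAnc⁺ : ∀ w u i → up i u ≡ w → isAnc T w u ≡ true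
  isAnc⁺ w u i upiu≡w with i N.<? k
  ... | yes i<k = ∈⇒isAnc w u (subst (_∈ ancestors T u) upiu≡w (∈-iterate⁺ parent k u i i<k))
  ... | no i≮k with reach u
  ...   | t , t<k , uptu≡root = ∈⇒isAnc w u (subst (_∈ ancestors T u) w≡root (reaches u))
    where
    w≡root : root ≡ w
    w≡root = trans (sym (up-≥ (ℕP.≤-trans (ℕP.<⇒≤ t<k) (ℕP.≮⇒≥ i≮k)) uptu≡root)) upiu≡w

  root-isAnc : ∀ u → isAnc T root u ≡ true
  root-isAnc u with reach u
  ... | t , _ , uptu≡root = isAnc⁺ root u t uptu≡root

  isAnc-parent : ∀ w l → w ≢ l → isAnc T w l ≡ isAnc T w (parent l)
  isAnc-parent w l w≢l = ⇔→≡ (mk⇔ toParent fromParent)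
    where
    toParent : isAnc T w l ≡ true → isAnc T w (parent l) ≡ true
    toParent isA with isAnc⁻ w l isA
    ... | zero , l≡w = ⊥-elim (w≢l (sym l≡w))
    ... | suc i , upi≡w = isAnc⁺ w (parent l) i upi≡w
    fromParent : isAnc T w (parent l) ≡ true → isAnc T w l ≡ true
    fromParent isA with isAnc⁻ w (parent l) isA
    ... | i , upi≡w = isAnc⁺ w l (suc i) upi≡w

  -- the parent relation has no cycles except the loop at the root, so
  -- ancestry is antisymmetric
  up-antisym : ∀ l₁ l₂ i j → up i l₂ ≡ l₁ → up j l₁ ≡ l₂ → l₁ ≡ l₂
  up-antisym l₁ l₂ i zero _ l₁≡l₂ = l₁≡l₂
  up-antisym l₁ l₂ i (suc j) upi≡l₁ upj≡l₂ = trans l₁≡root (sym l₂≡root)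
    where
    period : ℕ
    period = suc (j N.+ i)
    cycle : up period l₁ ≡ l₁
    cycle = trans (iterate-+ parent (suc j) i l₁) (trans (cong (up i) upj≡l₂) upi≡l₁)
    cycles : ∀ m → up (m N.* period) l₁ ≡ l₁
    cycles zero = refl
    cycles (suc m) = trans (iterate-+ parent period (m N.* period) l₁)
                       (trans (cong (up (m N.* period)) cycle) (cycles m))
    l₁≡root : l₁ ≡ root
    l₁≡root with reach l₁
    ... | t , _ , uptl₁≡root = trans (sym (cycles t)) (up-≥ (ℕP.m≤m*n t period) uptl₁≡root)
    l₂≡root : l₂ ≡ root
    l₂≡root = trans (sym upj≡l₂) (trans (cong (up (suc j)) l₁≡root) (iterate-fixed parent parent-root (suc j)))

  dist-nonneg : ∀ u v → 0ℚ ≤ dist T u v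
  dist-nonneg u v = maxWhere-nonneg wt (onPath T u v) (allFin k)

  dist-lub : ∀ u v {b} → 0ℚ ≤ b → (∀ w → onPath T u v w ≡ true → wt w ≤ b) → dist T u v ≤ b
  dist-lub u v = maxWhere-lub wt (onPath T u v) (allFin k)

  dist-≥ : ∀ u v w → onPath T u v w ≡ true → wt w ≤ dist T u v
  dist-≥ u v w = maxWhere-≥ wt (onPath T u v) (∈-allFin w)

  dist-sym : ∀ u v → dist T u v ≡ dist T v u
  dist-sym u v = maxWhere-cong wt
    (λ w → cong (not ⌊ w ≟ root ⌋ ∧_) (xor-comm (isAnc T w u) (isAnc T w v))) (allFin k)

  dist-self : ∀ u → dist T u u ≡ 0ℚ
  dist-self u = maxWhere-none wt (onPath T u u) (λ w → xor-self _ (isAnc T w u)) (allFin k)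

  dist-ultra : ∀ u m v → dist T u v ≤ dist T u m ⊔ dist T m v
  dist-ultra u m v = dist-lub u v (≤-trans (dist-nonneg u m) (p≤p⊔q (dist T u m) (dist T m v))) λ w onuv →
    [ (λ onum → ≤-trans (dist-≥ u m w onum) (p≤p⊔q (dist T u m) (dist T m v)))
    , (λ onmv → ≤-trans (dist-≥ m v w onmv) (p≤q⊔p (dist T u m) (dist T m v))) ]′
    (xor-split _ (isAnc T w u) (isAnc T w v) (isAnc T w m) onuv)

  dist-parent : ∀ l → l ≢ root → dist T l (parent l) ≤ wt l
  dist-parent l l≢root = dist-lub l (parent l) (<⇒≤ (WSTree.positive T l l≢root)) onlyEdge
    where
    onlyEdge : ∀ w → onPath T l (parent l) w ≡ true → wt w ≤ wt l
    onlyEdge w on with w ≟ l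
    ... | yes refl = ≤-refl
    ... | no w≢l with () ← trans (sym on)
            (subst (λ a → not ⌊ w ≟ root ⌋ ∧ (a xor isAnc T w (parent l)) ≡ false)
              (sym (isAnc-parent w l w≢l)) (xor-self (not ⌊ w ≟ root ⌋) (isAnc T w (parent l))))

  dist-self-≤ : ∀ {c} → 0ℚ ≤ c → ∀ l → dist T l l ≤ c
  dist-self-≤ 0≤c l = subst (_≤ _) (sym (dist-self l)) 0≤c

  climb-near : ∀ {c} → 0ℚ ≤ c → ∀ f l → dist T l (climb T c f l) ≤ c
  climb-near 0≤c zero l = dist-self-≤ 0≤c l
  climb-near {c} 0≤c (suc f) l with l ≟ root
  ... | yes _ = dist-self-≤ 0≤c l
  ... | no l≢root with wt l ≤ᵇ c in light
  ...   | false = dist-self-≤ 0≤c l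
  ...   | true = ≤-trans (dist-ultra l (parent l) (climb T c f (parent l)))
                   (⊔-lub (≤-trans (dist-parent l l≢root) (≤ᵇ⇒≤ (Equivalence.from T-≡ light)))
                          (climb-near 0≤c f (parent l)))

  Stopped : ℚ → Fin k → Set
  Stopped c l = l ≡ root ⊎ c < wt l

  climb-stops-within : ∀ c f l j → j N.≤ f → up j l ≡ root → Stopped c (climb T c f l)
  climb-stops-within c zero l zero _ l≡root = inj₁ l≡root
  climb-stops-within c (suc f) l j j≤f upj≡root with l ≟ root
  ... | yes l≡root = inj₁ l≡root
  ... | no l≢root with wt l ≤ᵇ c in light
  ...   | false = inj₂ (≰⇒> λ wt≤c → subst Data.Bool.T light (≤⇒≤ᵇ wt≤c))
  climb-stops-within c (suc f) l zero _ l≡root | no l≢root | true = ⊥-elim (l≢root l≡root)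
  climb-stops-within c (suc f) l (suc j) (s≤s j≤f) upj≡root | no _ | true =
    climb-stops-within c f (parent l) j j≤f upj≡root

  climb-stops : ∀ c l → Stopped c (climb T c k l)
  climb-stops c l with reach l
  ... | t , t<k , uptl≡root = climb-stops-within c k l t (ℕP.<⇒≤ t<k) uptl≡root

  -- the root is an ancestor of every node
  nonAncestor-≢root : ∀ l₁ l₂ → isAnc T l₁ l₂ ≡ false → l₁ ≢ root
  nonAncestor-≢root l₁ l₂ notAnc refl with () ← trans (sym (root-isAnc l₂)) notAnc

  -- if l₁ is stopped and not an ancestor of l₂, its heavy parent edge lies
  -- on the path to l₂
  stopped-unrelated : ∀ {c} l₁ l₂ → Stopped c l₁ → isAnc T l₁ l₂ ≡ false → c < dist T l₁ l₂
  stopped-unrelated l₁ l₂ (inj₁ l₁≡root) notAnc = ⊥-elim (nonAncestor-≢root l₁ l₂ notAnc l₁≡root)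
  stopped-unrelated l₁ l₂ (inj₂ c<wt) notAnc = <-≤-trans c<wt (dist-≥ l₁ l₂ l₁ onPath-own)
    where
    l₁≢root : l₁ ≢ root
    l₁≢root = nonAncestor-≢root l₁ l₂ notAnc
    onPath-own : onPath T l₁ l₂ l₁ ≡ true
    onPath-own with l₁ ≟ root
    ... | yes l₁≡root = ⊥-elim (l₁≢root l₁≡root)
    ... | no _ rewrite isAnc⁺ l₁ l₁ 0 refl | notAnc = refl

  stopped-separated : ∀ {c} l₁ l₂ → Stopped c l₁ → Stopped c l₂ → l₁ ≢ l₂ → c < dist T l₁ l₂
  stopped-separated l₁ l₂ st₁ st₂ l₁≢l₂ with isAnc T l₁ l₂ in anc₁₂
  ... | false = stopped-unrelated l₁ l₂ st₁ anc₁₂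
  ... | true with isAnc T l₂ l₁ in anc₂₁
  ...   | false = subst (_ <_) (dist-sym l₂ l₁) (stopped-unrelated l₂ l₁ st₂ anc₂₁)
  ...   | true with isAnc⁻ l₁ l₂ anc₁₂ | isAnc⁻ l₂ l₁ anc₂₁
  ...     | i , upi≡l₁ | j , upj≡l₂ = ⊥-elim (l₁≢l₂ (up-antisym l₁ l₂ i j upi≡l₁ upj≡l₂))

zipCost : {A : Set} → (A → A → ℚ) → List A → List A → ℚ
zipCost δ xs ys = foldr _+_ 0ℚ (zipWith δ xs ys)

module _ {A : Set} where

  zipCost-mono : {δ₁ δ₂ : A → A → ℚ} → (∀ a b → δ₁ a b ≤ δ₂ a b)
    → ∀ xs ys → zipCost δ₁ xs ys ≤ zipCost δ₂ xs ys
  zipCost-mono le [] ys = ≤-refl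
  zipCost-mono le (a ∷ xs) [] = ≤-refl
  zipCost-mono le (a ∷ xs) (b ∷ ys) = +-mono-≤ (le a b) (zipCost-mono le xs ys)

  zipCost-scale : {δ₁ δ₂ : A → A → ℚ} (c : ℚ) → (∀ a b → c * δ₁ a b ≤ δ₂ a b)
    → ∀ xs ys → c * zipCost δ₁ xs ys ≤ zipCost δ₂ xs ys
  zipCost-scale c le [] ys = ≤-reflexive (*-zeroʳ c)
  zipCost-scale c le (a ∷ xs) [] = ≤-reflexive (*-zeroʳ c)
  zipCost-scale {δ₁} c le (a ∷ xs) (b ∷ ys) =
    subst (_≤ _) (sym (*-distribˡ-+ c (δ₁ a b) (zipCost δ₁ xs ys)))
      (+-mono-≤ (le a b) (zipCost-scale c le xs ys))

  zipCost-map : (δ : A → A → ℚ) (f : A → A) → ∀ xs ys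
    → zipCost δ (map f xs) (map f ys) ≡ zipCost (λ a b → δ (f a) (f b)) xs ys
  zipCost-map δ f [] ys = refl
  zipCost-map δ f (a ∷ xs) [] = refl
  zipCost-map δ f (a ∷ xs) (b ∷ ys) = cong (λ t → δ (f a) (f b) + t) (zipCost-map δ f xs ys)

  zipCost-slack : {δ₁ δ₂ : A → A → ℚ} (c : ℚ) → (∀ a b → δ₁ a b ≤ δ₂ a b + c)
    → ∀ xs ys → length xs ≡ length ys
    → zipCost δ₁ xs ys ≤ zipCost δ₂ xs ys + fromℕ (length xs) * c
  zipCost-slack c le [] [] _ = ≤-reflexive (sym (trans (+-identityˡ _) (*-zeroˡ c)))
  zipCost-slack {δ₁} {δ₂} c le (a ∷ xs) (b ∷ ys) same = begin
    δ₁ a b + zipCost δ₁ xs ys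
      ≤⟨ +-mono-≤ (le a b) (zipCost-slack c le xs ys (ℕP.suc-injective same)) ⟩
    (δ₂ a b + c) + (zipCost δ₂ xs ys + L * c)
      ≡⟨ regroup (δ₂ a b) c (zipCost δ₂ xs ys) L ⟩
    (δ₂ a b + zipCost δ₂ xs ys) + (1ℚ + L) * c
      ≡⟨ cong (λ z → (δ₂ a b + zipCost δ₂ xs ys) + z * c) (sym (fromℕ-+ 1 (length xs))) ⟩
    (δ₂ a b + zipCost δ₂ xs ys) + fromℕ (suc (length xs)) * c ∎
    where
    open ≤-Reasoning
    open +-*-Solver
    L : ℚ
    L = fromℕ (length xs)
    regroup : ∀ d e t l → (d + e) + (t + l * e) ≡ (d + t) + (1ℚ + l) * e
    regroup = solve 4 (λ d e t l → (d :+ e) :+ (t :+ l :* e) := (d :+ t) :+ (con 1ℚ :+ l) :* e) refl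

dupFirst : ∀ {A : Set} {a : A} {xs z} → Expansion (a ∷ xs) z → Expansion (a ∷ xs) (a ∷ z)
dupFirst (keep e) = dup (keep e)
dupFirst (dup e) = dup (dup e)

Expansion-map : ∀ {A B : Set} (f : A → B) {x xb} → Expansion x xb → Expansion (map f x) (map f xb)
Expansion-map f [] = []
Expansion-map f (keep e) = keep (Expansion-map f e)
Expansion-map f (dup e) = dup (Expansion-map f e)

Expansion-unmap : ∀ {A B : Set} (f : A → B) (x : List A) {z} → Expansion (map f x) z
  → Σ (List A) λ xb → Expansion x xb × map f xb ≡ z
Expansion-unmap f [] [] = [] , [] , refl
Expansion-unmap f (a ∷ xs) (keep e) with Expansion-unmap f xs e
... | xb , e′ , fxb≡ = a ∷ xb , keep e′ , cong (f a ∷_) fxb≡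
Expansion-unmap f (a ∷ xs) (dup e) with Expansion-unmap f (a ∷ xs) e
... | xb , e′ , fxb≡ = a ∷ xb , dupFirst e′ , cong (f a ∷_) fxb≡

module _ {A : Set} where
  open Correspondence

  mapCorr : (f : A → A) {x y : List A} → Correspondence x y → Correspondence (map f x) (map f y)
  mapCorr f (corr xb yb ex ey same) = corr (map f xb) (map f yb) (Expansion-map f ex) (Expansion-map f ey)
    (trans (length-map f xb) (trans same (sym (length-map f yb))))

  cost-mapCorr : (f : A → A) (δ : A → A → ℚ) {x y : List A} (p : Correspondence x y)
    → cost δ (mapCorr f p) ≡ cost (λ a b → δ (f a) (f b)) p
  cost-mapCorr f δ (corr xb yb _ _ _) = zipCost-map δ f xb yb

  unmapCorr : (f : A → A) (δ : A → A → ℚ) {x y : List A} (p : Correspondence (map f x) (map f y))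
    → Σ (Correspondence x y) λ q → cost (λ a b → δ (f a) (f b)) q ≡ cost δ p
  unmapCorr f δ {x} {y} (corr xb yb ex ey same)
    with Expansion-unmap f x ex | Expansion-unmap f y ey
  ... | xl , exl , refl | yl , eyl , refl =
    corr xl yl exl eyl (trans (sym (length-map f xl)) (trans same (length-map f yl))) ,
    sym (zipCost-map δ f xl yl)

  -- for a nonnegative cost, a correspondence can be shortened to length at
  -- most |x| + |y| without increasing its cost: a step that advances in
  -- neither string is dropped
  shorten : (δ : A → A → ℚ) → (∀ a b → 0ℚ ≤ δ a b) → ∀ {x y xb yb}
    → Expansion x xb → Expansion y yb → length xb ≡ length yb
    → Σ (Correspondence x y) λ q → length (xbar q) N.≤ length x N.+ length y × cost δ q ≤ zipCost δ xb yb
  shorten δ δ≥0 [] [] _ = corr [] [] [] [] refl , z≤n , ≤-refl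
  shorten δ δ≥0 {a ∷ xs} {b ∷ ys} (keep ex) (keep ey) same
    with shorten δ δ≥0 ex ey (ℕP.suc-injective same)
  ... | corr xq yq exq eyq sameq , short , cheap =
    corr (a ∷ xq) (b ∷ yq) (keep exq) (keep eyq) (cong suc sameq) ,
    s≤s (ℕP.≤-trans short (ℕP.+-monoʳ-≤ (length xs) (ℕP.n≤1+n _))) ,
    +-monoʳ-≤ (δ a b) cheap
  shorten δ δ≥0 {a ∷ xs} {b ∷ ys} (dup ex) (dup ey) same
    with shorten δ δ≥0 ex ey (ℕP.suc-injective same)
  ... | q , short , cheap = q , short , ≤-trans cheap (≤-+-nonnegˡ (δ≥0 a b))
  shorten δ δ≥0 {a ∷ xs} {b ∷ ys} (dup ex) (keep ey) same
    with shorten δ δ≥0 ex ey (ℕP.suc-injective same)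
  ... | corr xq yq exq eyq sameq , short , cheap =
    corr (a ∷ xq) (b ∷ yq) (dupFirst exq) (keep eyq) (cong suc sameq) ,
    subst (suc (length xq) N.≤_) (sym (ℕP.+-suc (suc (length xs)) (length ys))) (s≤s short) ,
    +-monoʳ-≤ (δ a b) cheap
  shorten δ δ≥0 {a ∷ xs} {b ∷ ys} (keep ex) (dup ey) same
    with shorten δ δ≥0 ex ey (ℕP.suc-injective same)
  ... | corr xq yq exq eyq sameq , short , cheap =
    corr (a ∷ xq) (b ∷ yq) (keep exq) (dupFirst eyq) (cong suc sameq) , s≤s short ,
    +-monoʳ-≤ (δ a b) cheap

  shortenCorr : (δ : A → A → ℚ) → (∀ a b → 0ℚ ≤ δ a b) → {x y : List A} (p : Correspondence x y)
    → Σ (Correspondence x y) λ q → length (xbar q) N.≤ length x N.+ length y × cost δ q ≤ cost δ p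
  shortenCorr δ δ≥0 (corr _ _ ex ey same) = shorten δ δ≥0 ex ey same

module UltrametricSnap {k : ℕ} (δ : Fin k → Fin k → ℚ)
  (δ-self : ∀ a → δ a a ≡ 0ℚ) (δ-nonneg : ∀ a b → 0ℚ ≤ δ a b)
  (δ-sym : ∀ a b → δ a b ≡ δ b a) (δ-ultra : ∀ a m b → δ a b ≤ δ a m ⊔ δ m b)
  (c : ℚ) (0≤c : 0ℚ ≤ c) (s : Fin k → Fin k)
  (near : ∀ a → δ a (s a) ≤ c) (apart : ∀ a b → s a ≢ s b → c < δ (s a) (s b)) where
  open Correspondence using (xbar; ybar)

  δ-ultra₃ : ∀ a m m′ b → δ a b ≤ δ a m ⊔ (δ m m′ ⊔ δ m′ b)
  δ-ultra₃ a m m′ b = ≤-trans (δ-ultra a m b) (⊔-monoʳ-≤ (δ a m) (δ-ultra m m′ b))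

  near′ : ∀ a → δ (s a) a ≤ c
  near′ a = subst (_≤ c) (δ-sym a (s a)) (near a)

  snap-contracts : ∀ a b → δ (s a) (s b) ≤ δ a b
  snap-contracts a b with s a ≟ s b
  ... | yes sa≡sb = subst (λ z → δ (s a) z ≤ δ a b) sa≡sb
                      (subst (_≤ δ a b) (sym (δ-self (s a))) (δ-nonneg a b))
  ... | no sa≢sb = ≤-⊔-drop viaSb (≤-<-trans (near b) far)
    where
    far : c < δ (s a) (s b)
    far = apart a b sa≢sb
    viaSb : δ (s a) (s b) ≤ δ b (s b) ⊔ δ a b
    viaSb = subst (δ (s a) (s b) ≤_) (⊔-comm (δ a b) (δ b (s b)))
              (≤-⊔-drop (δ-ultra₃ (s a) a b (s b)) (≤-<-trans (near′ a) far))

  snap-within : ∀ a b → δ a b ≤ δ (s a) (s b) + c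
  snap-within a b = ≤-trans (δ-ultra₃ a (s a) (s b) b)
    (⊔-lub (≤-trans (near a) c≤) (⊔-lub (≤-+-nonnegʳ {δ (s a) (s b)} 0≤c) (≤-trans (near′ b) c≤)))
    where
    c≤ : c ≤ δ (s a) (s b) + c
    c≤ = ≤-+-nonnegˡ (δ-nonneg (s a) (s b))

  snap-discrete : ∀ a b → c * discrete (s a) (s b) ≤ δ (s a) (s b)
  snap-discrete a b with s a ≟ s b
  ... | yes _ = subst (_≤ δ (s a) (s b)) (sym (*-zeroʳ c)) (δ-nonneg (s a) (s b))
  ... | no sa≢sb = subst (_≤ δ (s a) (s b)) (sym (*-identityʳ c)) (<⇒≤ (apart a b sa≢sb))

  snapped-cost : ∀ {x y} (p : Correspondence x y) → cost δ (mapCorr s p) ≤ cost δ p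
  snapped-cost p = subst (_≤ cost δ p) (sym (cost-mapCorr s δ p))
    (zipCost-mono snap-contracts (xbar p) (ybar p))

  snap-DTW≤ : ∀ {x y B} → DTW≤ δ x y B → DTW≤ δ (map s x) (map s y) B
  snap-DTW≤ (p , cheap) = mapCorr s p , ≤-trans (snapped-cost p) cheap

  snap-DTW≤-discrete : ∀ {x y B B′} .{{_ : Positive c}} → B ≤ c * B′
    → DTW≤ δ x y B → DTW≤ discrete (map s x) (map s y) B′
  snap-DTW≤-discrete {B = B} {B′} B≤cB′ (p , cheap) = mapCorr s p , *-cancelˡ-≤-pos c (begin
    c * cost discrete (mapCorr s p)                   ≡⟨ cong (c *_) (cost-mapCorr s discrete p) ⟩
    c * cost (λ a b → discrete (s a) (s b)) p         ≤⟨ zipCost-scale c snap-discrete (xbar p) (ybar p) ⟩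
    cost (λ a b → δ (s a) (s b)) p                    ≡⟨ cost-mapCorr s δ p ⟨
    cost δ (mapCorr s p)                              ≤⟨ ≤-trans (snapped-cost p) cheap ⟩
    B                                                 ≤⟨ B≤cB′ ⟩
    c * B′                                            ∎)
    where open ≤-Reasoning

  -- lower bounds on DTW survive snapping up to the error c per step of a
  -- shortest correspondence, which has at most |x| + |y| ≤ m steps
  snap-DTW> : ∀ {x y B B′ m} → length x N.+ length y N.≤ m → B′ + fromℕ m * c ≤ B
    → DTW> δ x y B → DTW> δ (map s x) (map s y) B′
  snap-DTW> {x} {y} {B} {B′} {m} short B′+mc≤B far p
    with unmapCorr s δ p
  ... | q , cost-q with shortenCorr (λ a b → δ (s a) (s b)) (λ a b → δ-nonneg (s a) (s b)) q
  ... | corr xq yq exq eyq sameq , shortq , cheaper = +-cancelʳ-< (begin-strict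
    B′ + fromℕ m * c                                  ≤⟨ B′+mc≤B ⟩
    B                                                 <⟨ far (corr xq yq exq eyq sameq) ⟩
    zipCost δ xq yq                                   ≤⟨ zipCost-slack c snap-within xq yq sameq ⟩
    zipCost (λ a b → δ (s a) (s b)) xq yq + fromℕ (length xq) * c
      ≤⟨ +-mono-≤ (subst (_ ≤_) cost-q cheaper) (*-monoʳ-≤-nonNeg c {{nonNegative 0≤c}} steps) ⟩
    cost δ p + fromℕ m * c                            ∎)
    where
    open ≤-Reasoning
    steps : fromℕ (length xq) ≤ fromℕ m
    steps = fromℕ-mono (ℕP.≤-trans shortq short)

-- The arithmetic of the budgets for c = r/4: c·(4n/α) = nr/α, and an error
-- of c on each of 2n steps leaves nr/2 of the budget nr.
quarter-budget : ∀ n r β → (r * ((+ 1) // 4)) * (fromℕ (4 N.* n) * β) ≡ (fromℕ n * r) * β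
quarter-budget n r β = begin
  (r * ¼) * (fromℕ (4 N.* n) * β)          ≡⟨ cong (λ z → (r * ¼) * (z * β)) fourfold ⟩
  (r * ¼) * ((N + (N + (N + (N + 0ℚ)))) * β) ≡⟨ regroup r ¼ N β ⟩
  ((N * r) * β) * (¼ * (1ℚ + (1ℚ + (1ℚ + 1ℚ)))) ≡⟨ *-identityʳ _ ⟩
  (N * r) * β                               ∎
  where
  open ≡-Reasoning
  open +-*-Solver
  ¼ N : ℚ
  ¼ = (+ 1) // 4
  N = fromℕ n
  fourfold : fromℕ (4 N.* n) ≡ N + (N + (N + (N + 0ℚ)))
  fourfold = trans (fromℕ-+ n _) (cong (λ t → N + t) (trans (fromℕ-+ n _)
               (cong (λ t → N + t) (trans (fromℕ-+ n _) (cong (λ t → N + t) (fromℕ-+ n 0))))))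
  regroup : ∀ r q m b → (r * q) * ((m + (m + (m + (m + 0ℚ)))) * b)
                        ≡ ((m * r) * b) * (q * (1ℚ + (1ℚ + (1ℚ + 1ℚ))))
  regroup = solve 4 (λ r q m b → (r :* q) :* ((m :+ (m :+ (m :+ (m :+ con 0ℚ)))) :* b)
                                 := ((m :* r) :* b) :* (q :* (con 1ℚ :+ (con 1ℚ :+ (con 1ℚ :+ con 1ℚ))))) refl

half-budget : ∀ n r → (fromℕ n * r) * ((+ 1) // 2) + fromℕ (n N.+ n) * (r * ((+ 1) // 4)) ≡ fromℕ n * r
half-budget n r = begin
  X * ½ + fromℕ (n N.+ n) * (r * ¼)   ≡⟨ cong (λ t → X * ½ + t * (r * ¼)) (fromℕ-+ n n) ⟩
  X * ½ + (N + N) * (r * ¼)           ≡⟨ regroup N r ½ ¼ ⟩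
  X * (½ + (¼ + ¼))                   ≡⟨ *-identityʳ X ⟩
  X                                   ∎
  where
  open ≡-Reasoning
  open +-*-Solver
  ¼ ½ N X : ℚ
  ¼ = (+ 1) // 4
  ½ = (+ 1) // 2
  N = fromℕ n
  X = N * r
  regroup : ∀ m r h q → (m * r) * h + (m + m) * (r * q) ≡ (m * r) * (h + (q + q))
  regroup = solve 4 (λ m r h q → (m :* r) :* h :+ (m :+ m) :* (r :* q) := (m :* r) :* (h :+ (q :+ q))) refl

lemma4p6 : ∀ {k : ℕ} (T : WSTree k) (r α : ℚ) (n : ℕ) .{{_ : NonZero α}}
    → 1ℚ ≤ r → 1ℚ ≤ α → α ≤ (+ n) // 1
    → (x y : List (Fin k)) → Data.Nat._≤_ (length x) n → Data.Nat._≤_ (length y) n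
    → (∀ l₁ l₂ → l₁ ∈ simp T r x → l₂ ∈ simp T r y → l₁ ≢ l₂
    → r * ((+ 1) // 4) < dist T l₁ l₂)
    × (DTW≤ (dist T) x y ((((+ n) // 1) * r) ÷ α)
    → DTW≤ (dist T) (simp T r x) (simp T r y) ((((+ n) // 1) * r) ÷ α)
    × DTW≤ discrete (simp T r x) (simp T r y) (((+ (4 Data.Nat.* n)) // 1) ÷ α))
    × (DTW> (dist T) x y (((+ n) // 1) * r)
    → DTW> (dist T) (simp T r x) (simp T r y) ((((+ n) // 1) * r) * ((+ 1) // 2)))
lemma4p6 {k} T r α n 1≤r _ _ x y |x|≤n |y|≤n =
    separated
  , (λ close → snap-DTW≤ close
             , snap-DTW≤-discrete (≤-reflexive (sym (quarter-budget n r (1/ α)))) close)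
  , snap-DTW> (ℕP.+-mono-≤ |x|≤n |y|≤n) (≤-reflexive (half-budget n r))
  where
  open TreeMetric T
  c : ℚ
  c = r * ((+ 1) // 4)
  instance
    c-pos : Positive c
    c-pos = pos*pos⇒pos r {{positive (<-≤-trans (positive⁻¹ 1ℚ) 1≤r)}} ((+ 1) // 4)
  0≤c : 0ℚ ≤ c
  0≤c = <⇒≤ (positive⁻¹ c)
  s : Fin k → Fin k
  s = climb T c k
  open UltrametricSnap (dist T) dist-self dist-nonneg dist-sym dist-ultra c 0≤c s (climb-near 0≤c k)
    (λ a b → stopped-separated (s a) (s b) (climb-stops c a) (climb-stops c b))

  separated : ∀ l₁ l₂ → l₁ ∈ map s x → l₂ ∈ map s y → l₁ ≢ l₂ → c < dist T l₁ l₂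
  separated l₁ l₂ l₁∈ l₂∈ with ∈-map⁻ s l₁∈ | ∈-map⁻ s l₂∈
  ... | a , _ , refl | b , _ , refl = stopped-separated (s a) (s b) (climb-stops c a) (climb-stops c b)
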